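{- The connective constant of the lattice strip $\mathbb{Z}\times\{ -1,0,1,2\}$ satisfies $\mu_{[-1,2]}\geq \frac{1}{0.487645}\approx 2.050$, where $0.487645$ is (approximately) the radius of convergence of the power series of $\frac{1-t+t^2+t^3-t^4}{1-2t+t^3-2t^4-t^5}$.
   Context: A self-avoiding walk (SAW) of length $n$ on $\mathbb{Z}\times\{ -1,0,1,2\}$ is a sequence of distinct points $(w_0,\dots,w_n)$ of that strip with $w_0=(0,0)$ and consecutive points at $\ell^1$-distance $1$. With $c_{[-1,2]n}$ the number of such SAWs, $\mu_{[-1,2]}=\lim_{n\to\infty}\sqrt[n]{c_{[-1,2]n}}$. -}

module Defs where

open import Data.Nat using (ℕ; zero; suc)
open import Data.Integer using (ℤ; +_; -[1+_]; _+_; _-_; _≤_; _≤?_)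
import Data.Integer.Properties as ℤP
open import Data.Fin using (Fin; zero; suc)
open import Data.Vec using (Vec; []; _∷_)
open import Data.List using (List; []; _∷_; map; concatMap; length; filter)
open import Data.List.Relation.Unary.All using (All)
import Data.List.Relation.Unary.All as All
open import Data.List.Relation.Unary.Unique.Propositional using (Unique)
import Data.List.Relation.Unary.Unique.DecPropositional as UDec
open import Data.Product using (_×_; _,_; proj₂)
open import Data.Product.Properties using (≡-dec)
open import Relation.Nullary using (Dec)
open import Relation.Nullary.Decidable using (_×-dec_)
open import Relation.Unary using (Decidable)

Point : Set
Point = ℤ × ℤ

Dir : Set
Dir = Fin 4

step : Point → Dir → Point
step (x , y) zero                   = (x + + 1 , y)
step (x , y) (suc zero)             = (x - + 1 , y)
step (x , y) (suc (suc zero))       = (x , y + + 1)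
step (x , y) (suc (suc (suc zero))) = (x , y - + 1)

trace : ∀ {n} → Point → Vec Dir n → List Point
trace p []       = p ∷ []
trace p (d ∷ ds) = p ∷ trace (step p d) ds

origin : Point
origin = (+ 0 , + 0)

InStrip : Point → Set
InStrip (x , y) = (-[1+ 0 ] ≤ y) × (y ≤ + 2)

inStrip? : Decidable InStrip
inStrip? (x , y) = (-[1+ 0 ] ≤? y) ×-dec (y ≤? + 2)

IsSAWStrip : ∀ {n} → Vec Dir n → Set
IsSAWStrip ds = All InStrip (trace origin ds) × Unique (trace origin ds)

isSAWStrip? : ∀ {n} → Decidable (IsSAWStrip {n})
isSAWStrip? ds =
  All.all? inStrip? (trace origin ds)
  ×-dec UDec.unique? (≡-dec ℤP._≟_ ℤP._≟_) (trace origin ds)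

allDirs : List Dir
allDirs = zero ∷ suc zero ∷ suc (suc zero) ∷ suc (suc (suc zero)) ∷ []

allWalks : (n : ℕ) → List (Vec Dir n)
allWalks zero    = [] ∷ []
allWalks (suc n) = concatMap (λ d → map (d ∷_) (allWalks n)) allDirs

cStrip : ℕ → ℕ
cStrip n = length (filter isSAWStrip? (allWalks n))

-- The walks are generated by a finite automaton. A state records the height of the
-- current point and the region the rest of the walk may still visit, written in
-- coordinates (horizontal offset from the current point, height): every strip point at
-- least `threshold` columns to the right, plus finitely many listed exceptions. Each
-- transition lands in a region contained in the old one minus the point just left, so
-- every accepted word is a self-avoiding walk in the strip. The weights form an
-- approximate Perron eigenvector of the transfer matrix: 103 w(s) ≤ 50 Σ w(successors),
-- so the number of accepted walks of length n is at least (103/50)ⁿ/1000, and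
-- 103/50 = 2.06 exceeds 1/0.487645.

module Submission where

open import Defs
open import Data.Bool using (Bool; true; false; T)
open import Data.Empty using (⊥-elim)
open import Data.Fin using (Fin; zero; suc; #_)
open import Data.Fin.Properties using (all?)
open import Data.Integer using (ℤ; +_; 0ℤ; 1ℤ; -1ℤ)
  renaming (_+_ to _+ℤ_; _-_ to _-ℤ_; _≤_ to _≤ℤ_; _<_ to _<ℤ_)
import Data.Integer.Properties as ℤ
import Data.Integer.Tactic.RingSolver as ℤ-Solver
open import Data.List using (List; []; _∷_; _++_; map; concatMap; length; filter)
open import Data.List.Properties using (filter-++; filter-none; length-++; map-cong)
open import Data.List.Membership.Propositional using (_∈_)
open import Data.List.Relation.Binary.Sublist.Propositional using (⊆-refl)
open import Data.List.Relation.Binary.Sublist.Propositional.Properties using (filter⁺; length-mono-≤)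
open import Data.List.Relation.Unary.All as All using (All; []; _∷_)
open import Data.List.Relation.Unary.AllPairs using ([]; _∷_)
open import Data.List.Relation.Unary.Unique.Propositional using (Unique)
open import Data.Maybe using (Maybe; just; nothing; maybe′)
import Data.Maybe.Relation.Unary.All as Maybe
open import Data.Nat using (ℕ; zero; suc; _+_; _*_; _^_; _≤_; _<_; _≤?_; z≤n)
open import Data.Nat.ListAction using (sum)
open import Data.Nat.Properties
open import Data.Nat.Tactic.RingSolver using (solve-∀)
open import Data.Product using (_×_; _,_; proj₁; proj₂; ∃-syntax)
open import Data.Product.Properties using (≡-dec)
open import Data.List.Membership.DecPropositional (≡-dec ℤ._≟_ ℤ._≟_) using (_∈?_)
open import Data.Sum using (_⊎_; inj₁; inj₂)
open import Data.Unit using (tt)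
open import Data.Vec using (Vec; []; _∷_; lookup)
open import Level using (0ℓ)
open import Relation.Binary.PropositionalEquality
  using (_≡_; _≢_; refl; sym; trans; cong; cong₂; subst; subst₂; module ≡-Reasoning)
open import Relation.Nullary using (Dec; does; ¬?)
open import Relation.Nullary.Decidable using (_×-dec_; _⊎-dec_; T?; toWitness)
open import Relation.Unary using (Pred; Decidable)

module _ {A : Set} {P : Pred A 0ℓ} (P? : Decidable P) where

  length-filter-map : ∀ {B : Set} (f : B → A) xs →
    length (filter P? (map f xs)) ≡ length (filter (λ x → P? (f x)) xs)
  length-filter-map f []       = refl
  length-filter-map f (x ∷ xs) with does (P? (f x))
  ... | true  = cong suc (length-filter-map f xs)
  ... | false = length-filter-map f xs

  length-filter-concatMap : ∀ {B : Set} (f : B → List A) xs →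
    length (filter P? (concatMap f xs)) ≡ sum (map (λ x → length (filter P? (f x))) xs)
  length-filter-concatMap f []       = refl
  length-filter-concatMap f (x ∷ xs) = begin
    length (filter P? (f x ++ concatMap f xs))
      ≡⟨ cong length (filter-++ P? (f x) (concatMap f xs)) ⟩
    length (filter P? (f x) ++ filter P? (concatMap f xs))
      ≡⟨ length-++ (filter P? (f x)) ⟩
    length (filter P? (f x)) + length (filter P? (concatMap f xs))
      ≡⟨ cong (_+_ (length (filter P? (f x)))) (length-filter-concatMap f xs) ⟩
    length (filter P? (f x)) + sum (map (λ x → length (filter P? (f x))) xs) ∎
    where
      open ≡-Reasoning

  length-filter-mono : ∀ {Q : Pred A 0ℓ} (Q? : Decidable Q) → (∀ {x} → P x → Q x) →
    ∀ xs → length (filter P? xs) ≤ length (filter Q? xs)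
  length-filter-mono Q? P⇒Q xs = length-mono-≤ (filter⁺ P? Q? (λ { refl → P⇒Q }) (⊆-refl {x = xs}))

module _ {A : Set} where

  sum-map-*ʳ : (f : A → ℕ) (c : ℕ) → ∀ xs → sum (map (λ x → f x * c) xs) ≡ sum (map f xs) * c
  sum-map-*ʳ f c []       = refl
  sum-map-*ʳ f c (x ∷ xs) = trans (cong (_+_ (f x * c)) (sum-map-*ʳ f c xs))
                                  (sym (*-distribʳ-+ c (f x) (sum (map f xs))))

  sum-map-mono : {f g : A → ℕ} → (∀ x → f x ≤ g x) → ∀ xs → sum (map f xs) ≤ sum (map g xs)
  sum-map-mono f≤g []       = z≤n
  sum-map-mono f≤g (x ∷ xs) = +-mono-≤ (f≤g x) (sum-map-mono f≤g xs)

^-distrib-* : ∀ m n k → (m * n) ^ k ≡ m ^ k * n ^ k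
^-distrib-* m n zero    = refl
^-distrib-* m n (suc k) = trans (cong (m * n *_) (^-distrib-* m n k)) (interchange m n (m ^ k) (n ^ k))
  where
    interchange : ∀ a b x y → a * b * (x * y) ≡ a * x * (b * y)
    interchange = solve-∀

n^k*[n+k]≤[1+n]^[1+k] : ∀ n k → n ^ k * (n + k) ≤ suc n ^ suc k
n^k*[n+k]≤[1+n]^[1+k] n zero    = ≤-trans (≤-reflexive (lemma n)) (n≤1+n (n * 1))
  where
    lemma : ∀ n → 1 * (n + 0) ≡ n * 1
    lemma = solve-∀
n^k*[n+k]≤[1+n]^[1+k] n (suc k) = begin
  n * n ^ k * (n + suc k)                  ≡⟨ expand n (n ^ k) k ⟩
  n * (n ^ k * (n + k)) + n * n ^ k        ≤⟨ +-mono-≤ (*-monoʳ-≤ n (n^k*[n+k]≤[1+n]^[1+k] n k))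
                                                        (*-mono-≤ (n≤1+n n) (^-monoˡ-≤ k (n≤1+n n))) ⟩
  n * suc n ^ suc k + suc n * suc n ^ k    ≡⟨ collect n (suc n ^ k) ⟩
  suc n ^ suc (suc k)                      ∎
  where
    open ≤-Reasoning
    expand : ∀ n x k → n * x * (n + suc k) ≡ n * (x * (n + k)) + n * x
    expand = solve-∀
    collect : ∀ n y → n * (suc n * y) + suc n * y ≡ suc n * (suc n * y)
    collect = solve-∀

m*n^k<[1+n]^k : ∀ m n k → m * suc n < n + k → m * n ^ k < suc n ^ k
m*n^k<[1+n]^k m n k m[1+n]<n+k with n ^ k in n^k≡
... | zero  = subst (_< suc n ^ k) (sym (*-zeroʳ m)) (m^n>0 (suc n) k)
... | suc j = *-cancelʳ-< (suc n) (m * suc j) (suc n ^ k) (begin-strict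
  m * suc j * suc n     ≡⟨ reorder m (suc j) (suc n) ⟩
  suc j * (m * suc n)   <⟨ *-monoʳ-< (suc j) m[1+n]<n+k ⟩
  suc j * (n + k)       ≡⟨ cong (_* (n + k)) (sym n^k≡) ⟩
  n ^ k * (n + k)       ≤⟨ n^k*[n+k]≤[1+n]^[1+k] n k ⟩
  suc n * suc n ^ k     ≡⟨ *-comm (suc n) (suc n ^ k) ⟩
  suc n ^ k * suc n     ∎)
  where
    open ≤-Reasoning
    reorder : ∀ m x y → m * x * y ≡ x * (m * y)
    reorder = solve-∀

eventually-p^n<cₙq^n : (c : ℕ → ℕ) {a b M : ℕ} → (∀ n → a ^ n ≤ c n * (b ^ n * M)) →
  ∀ p q → b * p < a * q → ∃[ N ] (∀ n → N ≤ n → p ^ n < c n * q ^ n)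
eventually-p^n<cₙq^n c {a} {b} {M} a^n≤cₙbⁿM p q bp<aq =
  suc (M * suc (b * p)) , λ n N≤n →
    *-cancelʳ-< (b ^ n * M) (p ^ n) (c n * q ^ n) (begin-strict
      p ^ n * (b ^ n * M)          ≡⟨ reorder₁ (p ^ n) (b ^ n) M ⟩
      M * (b ^ n * p ^ n)          ≡⟨ cong (M *_) (sym (^-distrib-* b p n)) ⟩
      M * (b * p) ^ n              <⟨ m*n^k<[1+n]^k M (b * p) n (<-≤-trans N≤n (m≤n+m n (b * p))) ⟩
      suc (b * p) ^ n              ≤⟨ ^-monoˡ-≤ n bp<aq ⟩
      (a * q) ^ n                  ≡⟨ ^-distrib-* a q n ⟩
      a ^ n * q ^ n                ≤⟨ *-monoˡ-≤ (q ^ n) (a^n≤cₙbⁿM n) ⟩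
      c n * (b ^ n * M) * q ^ n    ≡⟨ reorder₂ (c n) (b ^ n * M) (q ^ n) ⟩
      c n * q ^ n * (b ^ n * M)    ∎)
  where
    open ≤-Reasoning
    reorder₁ : ∀ x y M → x * (y * M) ≡ M * (y * x)
    reorder₁ = solve-∀
    reorder₂ : ∀ x y z → x * y * z ≡ x * z * y
    reorder₂ = solve-∀

Δx Δy : Dir → ℤ
Δx zero                   = 1ℤ
Δx (suc zero)             = -1ℤ
Δx (suc (suc _))          = 0ℤ
Δy (suc (suc zero))       = 1ℤ
Δy (suc (suc (suc zero))) = -1ℤ
Δy _                      = 0ℤ

step-x : ∀ p d → proj₁ (step p d) ≡ proj₁ p +ℤ Δx d
step-x (x , y) zero                   = refl
step-x (x , y) (suc zero)             = refl
step-x (x , y) (suc (suc zero))       = sym (ℤ.+-identityʳ x)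
step-x (x , y) (suc (suc (suc zero))) = sym (ℤ.+-identityʳ x)

step-y : ∀ p d → proj₂ (step p d) ≡ proj₂ p +ℤ Δy d
step-y (x , y) zero                   = sym (ℤ.+-identityʳ y)
step-y (x , y) (suc zero)             = sym (ℤ.+-identityʳ y)
step-y (x , y) (suc (suc zero))       = refl
step-y (x , y) (suc (suc (suc zero))) = refl

module WalkAutomaton {S : Set} (δ : S → Dir → Maybe S) where

  accepts : ∀ {n} → Maybe S → Vec Dir n → Bool
  accepts nothing  _       = false
  accepts (just s) []      = true
  accepts (just s) (d ∷ w) = accepts (δ s d) w

  accepts? : ∀ {n} (m : Maybe S) → Decidable (λ (w : Vec Dir n) → T (accepts m w))
  accepts? m w = T? (accepts m w)

  successorSum : (Maybe S → ℕ) → S → ℕ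
  successorSum f s = sum (map (λ d → f (δ s d)) allDirs)

  count : Maybe S → ℕ → ℕ
  count nothing  _       = 0
  count (just s) zero    = 1
  count (just s) (suc n) = successorSum (λ m → count m n) s

  count-correct : ∀ m n → length (filter (accepts? m) (allWalks n)) ≡ count m n
  count-correct nothing  n       = cong length (filter-none (accepts? nothing) (All.universal (λ _ ()) (allWalks n)))
  count-correct (just s) zero    = refl
  count-correct (just s) (suc n) = begin
    length (filter (accepts? (just s)) (allWalks (suc n)))
      ≡⟨ length-filter-concatMap (accepts? (just s)) (λ d → map (d ∷_) (allWalks n)) allDirs ⟩
    sum (map (λ d → length (filter (accepts? (just s)) (map (d ∷_) (allWalks n)))) allDirs)
      ≡⟨ cong sum (map-cong (λ d → trans (length-filter-map (accepts? (just s)) (d ∷_) (allWalks n))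
                                         (count-correct (δ s d) n)) allDirs) ⟩
    count (just s) (suc n) ∎
    where
      open ≡-Reasoning

  module _ (a b M : ℕ) (v : S → ℕ)
           (supersolution : ∀ s → a * v s ≤ b * successorSum (maybe′ v 0) s)
           (v≤M : ∀ s → v s ≤ M) where

    count-lowerBound : ∀ m n → maybe′ v 0 m * a ^ n ≤ count m n * (b ^ n * M)
    count-lowerBound nothing  n       = z≤n
    count-lowerBound (just s) zero    = begin
      v s * 1        ≡⟨ *-identityʳ (v s) ⟩
      v s            ≤⟨ v≤M s ⟩
      M              ≡⟨ sym (trans (*-identityˡ (1 * M)) (*-identityˡ M)) ⟩
      1 * (1 * M)    ∎
      where
        open ≤-Reasoning
    count-lowerBound (just s) (suc n) = begin
      v s * (a * a ^ n)
        ≡⟨ reorder₁ (v s) a (a ^ n) ⟩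
      a * v s * a ^ n
        ≤⟨ *-monoˡ-≤ (a ^ n) (supersolution s) ⟩
      b * successorSum (maybe′ v 0) s * a ^ n
        ≡⟨ *-assoc b _ (a ^ n) ⟩
      b * (successorSum (maybe′ v 0) s * a ^ n)
        ≡⟨ cong (b *_) (sym (sum-map-*ʳ (λ d → maybe′ v 0 (δ s d)) (a ^ n) allDirs)) ⟩
      b * sum (map (λ d → maybe′ v 0 (δ s d) * a ^ n) allDirs)
        ≤⟨ *-monoʳ-≤ b (sum-map-mono (λ d → count-lowerBound (δ s d) n) allDirs) ⟩
      b * sum (map (λ d → count (δ s d) n * (b ^ n * M)) allDirs)
        ≡⟨ cong (b *_) (sum-map-*ʳ (λ d → count (δ s d) n) (b ^ n * M) allDirs) ⟩
      b * (count (just s) (suc n) * (b ^ n * M))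
        ≡⟨ reorder₂ b (count (just s) (suc n)) (b ^ n) M ⟩
      count (just s) (suc n) * (b * b ^ n * M)
        ∎
      where
        open ≤-Reasoning
        reorder₁ : ∀ v a x → v * (a * x) ≡ a * v * x
        reorder₁ = solve-∀
        reorder₂ : ∀ b c x M → b * (c * (x * M)) ≡ c * (b * x * M)
        reorder₂ = solve-∀

  module Avoidance (height : S → ℤ) (Allowed : S → ℤ → ℤ → Set) where

    Shrinks : S → Dir → S → Set
    Shrinks s d s' = height s' ≡ height s +ℤ Δy d
      × (∀ {dx y} → Allowed s' dx y → Allowed s (dx +ℤ Δx d) y × (dx +ℤ Δx d , y) ≢ (0ℤ , height s))

    Region : S → Point → Point → Set
    Region s p q = Allowed s (proj₁ q -ℤ proj₁ p) (proj₂ q)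

    offset-step : ∀ (q p : Point) d → proj₁ q -ℤ proj₁ (step p d) +ℤ Δx d ≡ proj₁ q -ℤ proj₁ p
    offset-step q p d = trans (cong (λ x → proj₁ q -ℤ x +ℤ Δx d) (step-x p d)) (cancel (proj₁ q) (proj₁ p) (Δx d))
      where
        cancel : ∀ a b e → a -ℤ (b +ℤ e) +ℤ e ≡ a -ℤ b
        cancel = ℤ-Solver.solve-∀

    height-step : ∀ {s d s'} → Shrinks s d s' → ∀ p → proj₂ p ≡ height s → proj₂ (step p d) ≡ height s'
    height-step {d = d} (height-eq , _) p p-at-height =
      trans (step-y p d) (trans (cong (_+ℤ Δy d) p-at-height) (sym height-eq))

    region-step : ∀ {s d s'} → Shrinks s d s' → ∀ p → proj₂ p ≡ height s →
      ∀ q → Region s' (step p d) q → Region s p q × q ≢ p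
    region-step {s} {d} (_ , shrink) p p-at-height q q∈ with shrink q∈
    ... | allowed , not-current =
      subst (λ dx → Allowed s dx (proj₂ q)) (offset-step q p d) allowed ,
      λ { refl → not-current (cong₂ _,_ (trans (offset-step p p d) (ℤ.+-inverseʳ (proj₁ p))) p-at-height) }

    module _ (allowed-here : ∀ s → Allowed s 0ℤ (height s))
             (shrinks : ∀ s d → Maybe.All (Shrinks s d) (δ s d)) where

      region-self : ∀ s p → proj₂ p ≡ height s → Region s p p
      region-self s p p-at-height =
        subst₂ (Allowed s) (sym (ℤ.+-inverseʳ (proj₁ p))) (sym p-at-height) (allowed-here s)

      accepted⇒avoiding : ∀ {n} s p → proj₂ p ≡ height s → (w : Vec Dir n) → T (accepts (just s) w) →
        All (Region s p) (trace p w) × Unique (trace p w)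
      accepted⇒avoiding s p p-at-height []      _   = region-self s p p-at-height ∷ [] , [] ∷ []
      accepted⇒avoiding s p p-at-height (d ∷ w) acc with δ s d | shrinks s d
      ... | nothing | _             = ⊥-elim acc
      ... | just s' | Maybe.just sh
        with accepted⇒avoiding s' (step p d) (height-step sh p p-at-height) w acc
      ...   | regions , unique =
        region-self s p p-at-height ∷ All.map (λ {q} q∈ → proj₁ (region-step sh p p-at-height q q∈)) regions ,
        All.map (λ {q} q∈ p≡q → proj₂ (region-step sh p p-at-height q q∈) (sym p≡q)) regions ∷ unique

      accepted⇒SAW : (∀ s {dx y} → Allowed s dx y → InStrip (dx , y)) →
        ∀ s₀ → height s₀ ≡ 0ℤ → ∀ {n} (w : Vec Dir n) → T (accepts (just s₀) w) → IsSAWStrip w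
      accepted⇒SAW allowed⇒inStrip s₀ s₀-at-origin w acc
        with accepted⇒avoiding s₀ origin (sym s₀-at-origin) w acc
      ... | regions , unique = All.map (allowed⇒inStrip s₀) regions , unique

State : Set
State = Fin 30

record StateData : Set where
  constructor state
  field
    height     : ℤ
    threshold  : ℤ
    weight     : ℕ
    next       : Vec (Maybe State) 4
    exceptions : List Point

-- The successors in `next` are listed in the order of Dir: right, left, up, down.
table : Vec StateData 30
table =
  state (+ 0) (+ 2) 474 (just (# 1) ∷ nothing ∷ nothing ∷ nothing ∷ [])
      ((+ 0 , + 0) ∷ (+ 1 , -1ℤ) ∷ (+ 1 , + 0) ∷ (+ 1 , + 1) ∷ (+ 1 , + 2) ∷ [])
  ∷ state (+ 0) (+ 1) 979 (just (# 2) ∷ nothing ∷ just (# 3) ∷ just (# 4) ∷ [])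
      ((+ 0 , -1ℤ) ∷ (+ 0 , + 0) ∷ (+ 0 , + 1) ∷ (+ 0 , + 2) ∷ [])
  ∷ state (+ 0) (+ 1) 1000 (just (# 2) ∷ nothing ∷ just (# 5) ∷ just (# 4) ∷ [])
      ((-1ℤ , + 1) ∷ (-1ℤ , + 2) ∷ (+ 0 , -1ℤ) ∷ (+ 0 , + 0) ∷ (+ 0 , + 1) ∷ (+ 0 , + 2) ∷ [])
  ∷ state (+ 1) (+ 1) 653 (just (# 6) ∷ nothing ∷ just (# 7) ∷ nothing ∷ [])
      ((+ 0 , + 1) ∷ (+ 0 , + 2) ∷ [])
  ∷ state -1ℤ (+ 2) 370 (just (# 8) ∷ nothing ∷ nothing ∷ nothing ∷ [])
      ((+ 0 , -1ℤ) ∷ (+ 1 , -1ℤ) ∷ (+ 1 , + 0) ∷ (+ 1 , + 1) ∷ (+ 1 , + 2) ∷ [])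
  ∷ state (+ 1) (+ 1) 695 (just (# 6) ∷ just (# 9) ∷ just (# 7) ∷ nothing ∷ [])
      ((-1ℤ , + 1) ∷ (-1ℤ , + 2) ∷ (+ 0 , + 1) ∷ (+ 0 , + 2) ∷ [])
  ∷ state (+ 1) (+ 1) 979 (just (# 10) ∷ nothing ∷ just (# 7) ∷ just (# 11) ∷ [])
      ((+ 0 , -1ℤ) ∷ (+ 0 , + 0) ∷ (+ 0 , + 1) ∷ (+ 0 , + 2) ∷ [])
  ∷ state (+ 2) (+ 2) 370 (just (# 12) ∷ nothing ∷ nothing ∷ nothing ∷ [])
      ((+ 0 , + 2) ∷ (+ 1 , -1ℤ) ∷ (+ 1 , + 0) ∷ (+ 1 , + 1) ∷ (+ 1 , + 2) ∷ [])
  ∷ state -1ℤ (+ 1) 765 (just (# 13) ∷ nothing ∷ just (# 14) ∷ nothing ∷ [])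
      ((+ 0 , -1ℤ) ∷ (+ 0 , + 0) ∷ (+ 0 , + 1) ∷ (+ 0 , + 2) ∷ [])
  ∷ state (+ 1) (+ 2) 86 (nothing ∷ nothing ∷ just (# 15) ∷ nothing ∷ [])
      ((+ 0 , + 1) ∷ (+ 0 , + 2) ∷ (+ 1 , + 2) ∷ [])
  ∷ state (+ 1) (+ 1) 999 (just (# 10) ∷ nothing ∷ just (# 7) ∷ just (# 16) ∷ [])
      ((-1ℤ , -1ℤ) ∷ (-1ℤ , + 0) ∷ (+ 0 , -1ℤ) ∷ (+ 0 , + 0) ∷ (+ 0 , + 1) ∷ (+ 0 , + 2) ∷ [])
  ∷ state (+ 0) (+ 1) 653 (just (# 1) ∷ nothing ∷ nothing ∷ just (# 4) ∷ [])
      ((+ 0 , -1ℤ) ∷ (+ 0 , + 0) ∷ [])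
  ∷ state (+ 2) (+ 1) 765 (just (# 17) ∷ nothing ∷ nothing ∷ just (# 18) ∷ [])
      ((+ 0 , -1ℤ) ∷ (+ 0 , + 0) ∷ (+ 0 , + 1) ∷ (+ 0 , + 2) ∷ [])
  ∷ state -1ℤ (+ 1) 791 (just (# 13) ∷ nothing ∷ just (# 19) ∷ nothing ∷ [])
      ((-1ℤ , + 0) ∷ (-1ℤ , + 1) ∷ (+ 0 , -1ℤ) ∷ (+ 0 , + 0) ∷ (+ 0 , + 1) ∷ (+ 0 , + 2) ∷ [])
  ∷ state (+ 0) (+ 1) 790 (just (# 1) ∷ nothing ∷ just (# 20) ∷ nothing ∷ [])
      ((+ 0 , + 0) ∷ (+ 0 , + 1) ∷ (+ 0 , + 2) ∷ [])
  ∷ state (+ 2) (+ 2) 179 (just (# 7) ∷ nothing ∷ nothing ∷ nothing ∷ [])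
      ((+ 0 , + 2) ∷ (+ 1 , + 2) ∷ [])
  ∷ state (+ 0) (+ 1) 695 (just (# 1) ∷ just (# 21) ∷ nothing ∷ just (# 4) ∷ [])
      ((-1ℤ , -1ℤ) ∷ (-1ℤ , + 0) ∷ (+ 0 , -1ℤ) ∷ (+ 0 , + 0) ∷ [])
  ∷ state (+ 2) (+ 1) 791 (just (# 17) ∷ nothing ∷ nothing ∷ just (# 22) ∷ [])
      ((-1ℤ , + 0) ∷ (-1ℤ , + 1) ∷ (+ 0 , -1ℤ) ∷ (+ 0 , + 0) ∷ (+ 0 , + 1) ∷ (+ 0 , + 2) ∷ [])
  ∷ state (+ 1) (+ 1) 790 (just (# 6) ∷ nothing ∷ nothing ∷ just (# 23) ∷ [])
      ((+ 0 , -1ℤ) ∷ (+ 0 , + 0) ∷ (+ 0 , + 1) ∷ [])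
  ∷ state (+ 0) (+ 1) 844 (just (# 1) ∷ just (# 24) ∷ just (# 20) ∷ nothing ∷ [])
      ((-1ℤ , + 0) ∷ (-1ℤ , + 1) ∷ (+ 0 , + 0) ∷ (+ 0 , + 1) ∷ (+ 0 , + 2) ∷ [])
  ∷ state (+ 1) (+ 1) 653 (just (# 6) ∷ nothing ∷ just (# 7) ∷ nothing ∷ [])
      ((+ 0 , + 1) ∷ (+ 0 , + 2) ∷ [])
  ∷ state (+ 0) (+ 2) 86 (nothing ∷ nothing ∷ nothing ∷ just (# 25) ∷ [])
      ((+ 0 , -1ℤ) ∷ (+ 0 , + 0) ∷ (+ 1 , -1ℤ) ∷ [])
  ∷ state (+ 1) (+ 1) 844 (just (# 6) ∷ just (# 26) ∷ nothing ∷ just (# 23) ∷ [])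
      ((-1ℤ , + 0) ∷ (-1ℤ , + 1) ∷ (+ 0 , -1ℤ) ∷ (+ 0 , + 0) ∷ (+ 0 , + 1) ∷ [])
  ∷ state (+ 0) (+ 1) 653 (just (# 1) ∷ nothing ∷ nothing ∷ just (# 4) ∷ [])
      ((+ 0 , -1ℤ) ∷ (+ 0 , + 0) ∷ [])
  ∷ state (+ 0) (+ 2) 111 (nothing ∷ nothing ∷ just (# 27) ∷ nothing ∷ [])
      ((+ 0 , + 0) ∷ (+ 0 , + 1) ∷ (+ 1 , + 1) ∷ [])
  ∷ state -1ℤ (+ 2) 179 (just (# 4) ∷ nothing ∷ nothing ∷ nothing ∷ [])
      ((+ 0 , -1ℤ) ∷ (+ 1 , -1ℤ) ∷ [])
  ∷ state (+ 1) (+ 2) 111 (nothing ∷ nothing ∷ nothing ∷ just (# 28) ∷ [])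
      ((+ 0 , + 0) ∷ (+ 0 , + 1) ∷ (+ 1 , + 0) ∷ [])
  ∷ state (+ 1) (+ 2) 229 (just (# 29) ∷ nothing ∷ nothing ∷ nothing ∷ [])
      ((+ 0 , + 1) ∷ (+ 1 , + 1) ∷ [])
  ∷ state (+ 0) (+ 2) 229 (just (# 0) ∷ nothing ∷ nothing ∷ nothing ∷ [])
      ((+ 0 , + 0) ∷ (+ 1 , + 0) ∷ [])
  ∷ state (+ 1) (+ 2) 474 (just (# 6) ∷ nothing ∷ nothing ∷ nothing ∷ [])
      ((+ 0 , + 1) ∷ (+ 1 , -1ℤ) ∷ (+ 1 , + 0) ∷ (+ 1 , + 1) ∷ (+ 1 , + 2) ∷ [])
  ∷ []

height threshold : State → ℤ
height    s = StateData.height (lookup table s)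
threshold s = StateData.threshold (lookup table s)

weight : State → ℕ
weight s = StateData.weight (lookup table s)

exceptions : State → List Point
exceptions s = StateData.exceptions (lookup table s)

δ : State → Dir → Maybe State
δ s = lookup (StateData.next (lookup table s))

s₀ : State
s₀ = # 0

Allowed : State → ℤ → ℤ → Set
Allowed s dx y = (threshold s ≤ℤ dx × InStrip (dx , y)) ⊎ (dx , y) ∈ exceptions s

allowed? : ∀ s dx y → Dec (Allowed s dx y)
allowed? s dx y = ((threshold s ℤ.≤? dx) ×-dec inStrip? (dx , y)) ⊎-dec ((dx , y) ∈? exceptions s)

open WalkAutomaton δ
open Avoidance height Allowed

ExceptionShrinks : State → Dir → Point → Set
ExceptionShrinks s d (a , y) = Allowed s (a +ℤ Δx d) y × (a +ℤ Δx d , y) ≢ (0ℤ , height s)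

TransitionCheck : State → Dir → State → Set
TransitionCheck s d s' = height s' ≡ height s +ℤ Δy d
  × threshold s ≤ℤ threshold s' +ℤ Δx d × 0ℤ <ℤ threshold s' +ℤ Δx d
  × All (ExceptionShrinks s d) (exceptions s')

StateCheck : State → Set
StateCheck s = Allowed s 0ℤ (height s) × All InStrip (exceptions s)
  × (∀ d → Maybe.All (TransitionCheck s d) (δ s d))

stateCheck? : ∀ s → Dec (StateCheck s)
stateCheck? s = allowed? s 0ℤ (height s) ×-dec All.all? inStrip? (exceptions s)
  ×-dec all? (λ d → Maybe.dec (transitionCheck? d) (δ s d))
  where
    exceptionShrinks? : ∀ d e → Dec (ExceptionShrinks s d e)
    exceptionShrinks? d (a , y) = allowed? s (a +ℤ Δx d) y ×-dec ¬? (≡-dec ℤ._≟_ ℤ._≟_ (a +ℤ Δx d , y) (0ℤ , height s))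
    transitionCheck? : ∀ d s' → Dec (TransitionCheck s d s')
    transitionCheck? d s' = (height s' ℤ.≟ height s +ℤ Δy d)
      ×-dec (threshold s ℤ.≤? threshold s' +ℤ Δx d) ×-dec (0ℤ ℤ.<? threshold s' +ℤ Δx d)
      ×-dec All.all? (exceptionShrinks? d) (exceptions s')

stateChecks : ∀ s → StateCheck s
stateChecks = toWitness {a? = all? stateCheck?} tt

transitionCheck⇒shrinks : ∀ {s d s'} → TransitionCheck s d s' → Shrinks s d s'
transitionCheck⇒shrinks {s} {d} {s'} (height-eq , threshold-step , threshold-positive , exceptions-shrink) =
  height-eq , shrink
  where
    shrink : ∀ {dx y} → Allowed s' dx y → Allowed s (dx +ℤ Δx d) y × (dx +ℤ Δx d , y) ≢ (0ℤ , height s)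
    shrink {dx} (inj₁ (t'≤dx , inStrip)) =
      inj₁ (ℤ.≤-trans threshold-step t'+Δx≤dx+Δx , inStrip) ,
      λ eq → ℤ.<-irrefl (sym (cong proj₁ eq)) (ℤ.<-≤-trans threshold-positive t'+Δx≤dx+Δx)
      where
        t'+Δx≤dx+Δx : threshold s' +ℤ Δx d ≤ℤ dx +ℤ Δx d
        t'+Δx≤dx+Δx = ℤ.+-monoˡ-≤ (Δx d) t'≤dx
    shrink (inj₂ e∈) = All.lookup exceptions-shrink e∈

shrinks : ∀ s d → Maybe.All (Shrinks s d) (δ s d)
shrinks s d = Maybe.map (λ {s'} → transitionCheck⇒shrinks {s} {d} {s'}) (proj₂ (proj₂ (stateChecks s)) d)

allowed⇒inStrip : ∀ s {dx y} → Allowed s dx y → InStrip (dx , y)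
allowed⇒inStrip s (inj₁ (_ , inStrip)) = inStrip
allowed⇒inStrip s (inj₂ e∈) = All.lookup (proj₁ (proj₂ (stateChecks s))) e∈

weights-supersolution : ∀ s → 103 * weight s ≤ 50 * successorSum (maybe′ weight 0) s
weights-supersolution = toWitness {a? = all? (λ s → 103 * weight s ≤? 50 * successorSum (maybe′ weight 0) s)} tt

weights-bounded : ∀ s → weight s ≤ 1000
weights-bounded = toWitness {a? = all? (λ s → weight s ≤? 1000)} tt

cStrip-lowerBound : ∀ n → 103 ^ n ≤ cStrip n * (50 ^ n * 1000)
cStrip-lowerBound n = begin
  103 ^ n
    ≤⟨ m≤n*m (103 ^ n) (weight s₀) ⟩
  weight s₀ * 103 ^ n
    ≤⟨ count-lowerBound 103 50 1000 weight weights-supersolution weights-bounded (just s₀) n ⟩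
  count (just s₀) n * (50 ^ n * 1000)
    ≡⟨ cong (_* (50 ^ n * 1000)) (sym (count-correct (just s₀) n)) ⟩
  length (filter (accepts? (just s₀)) (allWalks n)) * (50 ^ n * 1000)
    ≤⟨ *-monoˡ-≤ (50 ^ n * 1000) (length-filter-mono (accepts? (just s₀)) isSAWStrip? accepted⇒isSAW (allWalks n)) ⟩
  cStrip n * (50 ^ n * 1000)
    ∎
  where
    open ≤-Reasoning
    accepted⇒isSAW : ∀ {w : Vec Dir n} → T (accepts (just s₀) w) → IsSAWStrip w
    accepted⇒isSAW {w} = accepted⇒SAW (λ s → proj₁ (stateChecks s)) shrinks allowed⇒inStrip s₀ refl w

<1000000/487645⇒<103/50 : ∀ p q → p * 487645 < q * 1000000 → 50 * p < 103 * q
<1000000/487645⇒<103/50 p q p*487645<q*1000000 = *-cancelʳ-< 487645 (50 * p) (103 * q) (begin-strict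
  50 * p * 487645    ≡⟨ reorder p ⟩
  50 * (p * 487645)  <⟨ *-monoʳ-< 50 p*487645<q*1000000 ⟩
  50 * (q * 1000000) ≡⟨ expand₁ q ⟩
  q * 50000000       ≤⟨ *-monoʳ-≤ q (m≤m+n 50000000 227435) ⟩
  q * 50227435       ≡⟨ expand₂ q ⟩
  103 * q * 487645   ∎)
  where
    open ≤-Reasoning
    reorder : ∀ p → 50 * p * 487645 ≡ 50 * (p * 487645)
    reorder = solve-∀
    expand₁ : ∀ q → 50 * (q * 1000000) ≡ q * 50000000
    expand₁ = solve-∀
    expand₂ : ∀ q → q * 50227435 ≡ 103 * q * 487645
    expand₂ = solve-∀

mainTheorem4 : (p q : ℕ) → 0 < q → p * 487645 < q * 1000000 →
    ∃[ N ] ((n : ℕ) → N ≤ n → p ^ n < cStrip n * q ^ n)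
mainTheorem4 p q _ p/q<bound =
  eventually-p^n<cₙq^n cStrip cStrip-lowerBound p q (<1000000/487645⇒<103/50 p q p/q<bound)
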